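{- Let $m\in\mathbb{N}\setminus\{0,1\}$. Then the graph $G(m)$ is a tree with root $\{0\}\cup\{x\in\mathbb{N}\mid x\ge m\}$. Moreover, for every positive integer $k$, $\{S\in\mathcal{L}_m\mid \mathrm{C}(S)=k\}$ is the set of $S\in\mathcal{L}_m$ connected with $\{0\}\cup\{x\in\mathbb{N}\mid x\ge m\}$ through a path of length $k-1$ in $G(m)$.
   Context: A numerical semigroup is a subset $S\subseteq\mathbb{N}$ containing $0$, closed under addition, with finite complement in $\mathbb{N}$; $\mathrm{F}(S)=\max(\mathbb{Z}\setminus S)$, $\mathrm{m}(S)=\min(S\setminus\{0\})$. $\mathcal{L}_m$ is the set of numerical semigroups with multiplicity $m$. For $S\ne\mathbb{N}$, $\gamma(S)=\{x\in\mathbb{N}\setminus S\mid \lfloor \mathrm{F}(S)/\mathrm{m}(S)\rfloor\,\mathrm{m}(S)\le x\le\mathrm{F}(S)\}$. $G(m)$ is the directed graph with vertex set $\mathcal{L}_m$ in which $(S,T)\in\mathcal{L}_m\times\mathcal{L}_m$ is an edge iff $T=S\cup\gamma(S)$ (and $S\ne T$). A path of length $n$ from $u$ to $v$ is a sequence of distinct edges $(v_0,v_1),\dots,(v_{n-1},v_n)$ with $v_0=u$, $v_n=v$; a graph is a tree with root $r$ if every other vertex is connected to $r$ by a unique path. An ideal of a numerical semigroup $\Delta$ is a nonempty $I\subseteq\Delta$ with $I+\Delta\subseteq I$; $\mathcal{J}(\Delta)$ is the set of numerical semigroups $U$ with $U\setminus\{0\}$ an ideal of $\Delta$; $\mathcal{J}(\mathscr{F})=\bigcup_{\Delta\in\mathscr{F}}\mathcal{J}(\Delta)$;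 $\mathcal{J}^0(\mathbb{N})=\{\mathbb{N}\}$, $\mathcal{J}^{k+1}(\mathbb{N})=\mathcal{J}(\mathcal{J}^k(\mathbb{N}))$; the complexity is $\mathrm{C}(S)=\min\{k\in\mathbb{N}\mid S\in\mathcal{J}^k(\mathbb{N})\}$. -}

module Defs where

open import Data.Nat using (ℕ; zero; suc; _+_; _*_; _∸_; _≤_; _<_; _≤ᵇ_)
open import Data.Bool using (Bool; true; false; _∨_)
open import Data.Product using (Σ; ∃; _×_; _,_)
open import Data.Sum using (_⊎_)
open import Relation.Nullary using (¬_)
open import Relation.Binary.PropositionalEquality using (_≡_; _≢_)

Subset : Set
Subset = ℕ → Bool

_∈_ : ℕ → Subset → Set
x ∈ S = S x ≡ true

_∉_ : ℕ → Subset → Set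
x ∉ S = S x ≡ false

_≐_ : Subset → Subset → Set
S ≐ T = ∀ x → S x ≡ T x

ℕset : Subset
ℕset _ = true

record IsNumericalSemigroup (S : Subset) : Set where
  field
    zero∈   : 0 ∈ S
    +-closed : ∀ x y → x ∈ S → y ∈ S → (x + y) ∈ S
    cofinite : ∃ λ N → ∀ x → N ≤ x → x ∈ S

-- f is the Frobenius number F(S) (for S ≠ ℕ, so f ∈ ℕ)
IsFrobenius : Subset → ℕ → Set
IsFrobenius S f = f ∉ S × (∀ x → f < x → x ∈ S)

IsMultiplicity : Subset → ℕ → Set
IsMultiplicity S mu = 0 < mu × mu ∈ S × (∀ x → 0 < x → x < mu → x ∉ S)

-- x ∈ γ(S) : x ∉ S and ⌊F/m⌋ m ≤ x ≤ F, with ⌊F/m⌋ given by its defining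
-- property q*m ≤ F < (q+1)*m
InGamma : Subset → ℕ → Set
InGamma S x = ∃ λ f → ∃ λ mu → ∃ λ q →
  IsFrobenius S f × IsMultiplicity S mu ×
  q * mu ≤ f × f < suc q * mu ×
  x ∉ S × q * mu ≤ x × x ≤ f

InL : ℕ → Subset → Set
InL m S = IsNumericalSemigroup S × IsMultiplicity S m

Edge : ℕ → Subset → Subset → Set
Edge m S T = InL m S × InL m T × ¬ (S ≐ T) ×
  (∀ x → x ∈ T → (x ∈ S ⊎ InGamma S x)) ×
  (∀ x → (x ∈ S ⊎ InGamma S x) → x ∈ T)

Path : ℕ → Subset → Subset → ℕ → Set
Path m u v n = Σ (ℕ → Subset) λ vs →
  (vs 0 ≐ u) × (vs n ≐ v) ×
  (∀ i → i < n → Edge m (vs i) (vs (suc i))) ×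
  (∀ i j → i < n → j < n → i ≢ j →
     ¬ ((vs i ≐ vs j) × (vs (suc i) ≐ vs (suc j))))

SamePath : ∀ {m u v n n'} → Path m u v n → Path m u v n' → Set
SamePath {n = n} {n'} (vs , _) (ws , _) = n ≡ n' × (∀ i → i ≤ n → vs i ≐ ws i)

IsTreeWithRoot : ℕ → Subset → Set
IsTreeWithRoot m r = InL m r ×
  (∀ S → InL m S → ¬ (S ≐ r) →
     (∃ λ n → Path m S r n) ×
     (∀ n n' (p : Path m S r n) (q : Path m S r n') → SamePath p q))

rootSG : ℕ → Subset
rootSG m zero = true
rootSG m (suc x) = m ≤ᵇ suc x

IsIdealMinusZero : Subset → Subset → Set
IsIdealMinusZero U Δ =
  (∃ λ x → x ≢ 0 × x ∈ U) ×
  (∀ x → x ≢ 0 → x ∈ U → x ∈ Δ) ×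
  (∀ x y → x ≢ 0 → x ∈ U → y ∈ Δ → (x + y) ∈ U)

J^ : ℕ → Subset → Set
J^ zero U = U ≐ ℕset
J^ (suc k) U = ∃ λ Δ → J^ k Δ × IsNumericalSemigroup U × IsIdealMinusZero U Δ

HasComplexity : Subset → ℕ → Set
HasComplexity S k = J^ k S × (∀ j → j < k → ¬ J^ j S)

-- Call a(S) = ⌊F(S)/m⌋ the level of S ∈ 𝓛_m: S contains every x ≥ (a+1)m and misses
-- some x ≥ am. Then S ∪ γ(S) = S ∪ [am, ∞), which lies in 𝓛_m exactly when a ≥ 1 and then
-- has level a − 1, while the root is the only member of 𝓛_m of level 0. So edges lower the
-- level by one and are determined by their source: the path from S to the root is unique
-- and has length a(S). On the other side, S ∈ 𝓙^j(ℕ) iff S ⊇ [jm, ∞): each layer of an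
-- ideal tower allows adding m ∈ S once more, and conversely S ∖ {0} is an ideal of
-- S ∪ [(j−1)m, ∞). Hence C(S) = a(S) + 1.

{-# OPTIONS --safe #-}

module Submission where

open import Defs
open import Data.Bool using (Bool; true; false; _∨_)
open import Data.Bool.Properties using (T-≡; ¬-not; not-¬; ∨-zeroʳ)
open import Data.Nat
  using (ℕ; zero; suc; _+_; _*_; _∸_; _≤_; _<_; _≤ᵇ_; z≤n; s≤s; z<s; _≟_; NonZero; >-nonZero)
open import Data.Nat.Properties
open import Data.Nat.DivMod using (_/_; _%_; m≡m%n+[m/n]*n; m%n<n; m/n*n≤m)
open import Data.Product using (∃; _×_; _,_; proj₁; proj₂; map₂)
open import Data.Sum using (_⊎_; inj₁; inj₂)
open import Function.Bundles using (Equivalence)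
open import Relation.Nullary using (¬_; yes; no; contradiction)
open import Relation.Binary.Definitions using (tri<; tri≈; tri>)
open import Relation.Binary.PropositionalEquality

variable
  m n a b c f i j k x y : ℕ
  S T U V : Subset
  vs : ℕ → Subset

-- Stated for the Bool S x itself, since S and x cannot be inferred from it.
∉⇒¬∈ : {b : Bool} → b ≡ false → ¬ b ≡ true
∉⇒¬∈ = not-¬

¬∈⇒∉ : {b : Bool} → ¬ b ≡ true → b ≡ false
¬∈⇒∉ = ¬-not

∈-or-∉ : ∀ S x → x ∈ S ⊎ x ∉ S
∈-or-∉ S x with S x
... | true  = inj₁ refl
... | false = inj₂ refl

≐-sym : S ≐ T → T ≐ S
≐-sym S≐T x = sym (S≐T x)

≐-trans : S ≐ T → T ≐ U → S ≐ U
≐-trans S≐T T≐U x = trans (S≐T x) (T≐U x)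

≐-intro : (∀ x → x ∈ S → x ∈ T) → (∀ x → x ∈ T → x ∈ S) → S ≐ T
≐-intro {S} {T} S⊆T T⊆S x with S x in Sx | T x in Tx
... | true  | true  = refl
... | false | false = refl
... | true  | false = sym (trans (sym Tx) (S⊆T x Sx))
... | false | true  = trans (sym Sx) (T⊆S x Tx)

∈-resp-≐ : S ≐ T → x ∈ S → x ∈ T
∈-resp-≐ {x = x} S≐T = trans (sym (S≐T x))

∉-resp-≐ : S ≐ T → x ∉ S → x ∉ T
∉-resp-≐ {x = x} S≐T = trans (sym (S≐T x))

≤ᵇ-true : c ≤ x → (c ≤ᵇ x) ≡ true
≤ᵇ-true c≤x = Equivalence.to T-≡ (≤⇒≤ᵇ c≤x)

≤ᵇ-false : ¬ c ≤ x → (c ≤ᵇ x) ≡ false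
≤ᵇ-false {c} {x} c≰x = ¬-not (λ c≤ᵇx → c≰x (≤ᵇ⇒≤ c x (Equivalence.from T-≡ c≤ᵇx)))

infixl 5 _∪≥_
infix  4 _⊇≥_

-- S ∪≥ c = S ∪ [c, ∞), kept opaque so that unification can recover S and c from it.
opaque
  _∪≥_ : Subset → ℕ → Subset
  (S ∪≥ c) x = S x ∨ (c ≤ᵇ x)

_⊇≥_ : Subset → ℕ → Set
S ⊇≥ c = ∀ x → c ≤ x → x ∈ S

opaque
  unfolding _∪≥_

  ∪≥-introˡ : x ∈ S → x ∈ (S ∪≥ c)
  ∪≥-introˡ x∈S rewrite x∈S = refl

  ∪≥-introʳ : c ≤ x → x ∈ (S ∪≥ c)
  ∪≥-introʳ {x = x} {S = S} c≤x rewrite ≤ᵇ-true c≤x = ∨-zeroʳ (S x)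

  ∪≥-elim : x ∈ (S ∪≥ c) → x ∈ S ⊎ c ≤ x
  ∪≥-elim {x} {S} {c} x∈ with S x
  ... | true  = inj₁ refl
  ... | false = inj₂ (≤ᵇ⇒≤ c x (Equivalence.from T-≡ x∈))

  ∪≥-∉ : x ∉ S → x < c → x ∉ (S ∪≥ c)
  ∪≥-∉ x∉S x<c rewrite x∉S = ≤ᵇ-false (<⇒≱ x<c)

  ∪≥-resp-≐ : S ≐ T → (S ∪≥ c) ≐ (T ∪≥ c)
  ∪≥-resp-≐ {c = c} S≐T x = cong (_∨ (c ≤ᵇ x)) (S≐T x)

⊇≥∧∉⇒< : S ⊇≥ c → x ∉ S → x < c
⊇≥∧∉⇒< {c = c} {x = x} S⊇ x∉S with c ≤? x
... | yes c≤x = contradiction (S⊇ x c≤x) (∉⇒¬∈ x∉S)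
... | no  c≰x = ≰⇒> c≰x

∉⇒≤frobenius : IsFrobenius S f → x ∉ S → x ≤ f
∉⇒≤frobenius {f = f} {x = x} (_ , S>f) x∉S with x ≤? f
... | yes x≤f = x≤f
... | no  x≰f = contradiction (S>f x (≰⇒> x≰f)) (∉⇒¬∈ x∉S)

frobenius-exists : S ⊇≥ n → y ∉ S → ∃ (IsFrobenius S)
frobenius-exists {n = zero} S⊇ y∉S = contradiction (S⊇ _ z≤n) (∉⇒¬∈ y∉S)
frobenius-exists {S = S} {n = suc n} S⊇ y∉S with ∈-or-∉ S n
... | inj₂ n∉S = n , n∉S , S⊇
... | inj₁ n∈S = frobenius-exists S⊇n y∉S
  where
  S⊇n : S ⊇≥ n
  S⊇n x n≤x with m≤n⇒m<n∨m≡n n≤x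
  ... | inj₁ n<x  = S⊇ x n<x
  ... | inj₂ refl = n∈S

∸-∉ : IsNumericalSemigroup S → a ∈ S → y ∉ S → a ≤ y → (y ∸ a) ∉ S
∸-∉ {S = S} {a} {y} S-sg a∈S y∉S a≤y = ¬∈⇒∉ λ y∸a∈S →
  ∉⇒¬∈ y∉S (subst (_∈ S) (m+[n∸m]≡n a≤y) (IsNumericalSemigroup.+-closed S-sg a (y ∸ a) a∈S y∸a∈S))

multiplicity-unique : IsMultiplicity S a → IsMultiplicity S b → a ≡ b
multiplicity-unique {a = a} {b = b} (0<a , a∈S , S<a) (0<b , b∈S , S<b) with <-cmp a b
... | tri< a<b _ _ = contradiction a∈S (∉⇒¬∈ (S<b a 0<a a<b))
... | tri≈ _ a≡b _ = a≡b
... | tri> _ _ b<a = contradiction b∈S (∉⇒¬∈ (S<a b 0<b b<a))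

multiplicity-≤ : IsMultiplicity S m → x ∈ S → x ≢ 0 → m ≤ x
multiplicity-≤ {m = m} {x = x} (_ , _ , S<m) x∈S x≢0 with m ≤? x
... | yes m≤x = m≤x
... | no  m≰x = contradiction x∈S (∉⇒¬∈ (S<m x (n≢0⇒n>0 x≢0) (≰⇒> m≰x)))

one∉ : IsMultiplicity S m → 1 < m → 1 ∉ S
one∉ (_ , _ , S<m) 1<m = S<m 1 z<s 1<m

∪≥-InL : InL m S → m ≤ c → InL m (S ∪≥ c)
∪≥-InL {m} {S} {c} (S-sg , 0<m , m∈S , S<m) m≤c = Δ-sg , 0<m , ∪≥-introˡ m∈S , Δ<m
  where
  open IsNumericalSemigroup S-sg
  closed : ∀ x y → x ∈ (S ∪≥ c) → y ∈ (S ∪≥ c) → (x + y) ∈ (S ∪≥ c)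
  closed x y x∈ y∈ with ∪≥-elim {S = S} x∈ | ∪≥-elim {S = S} y∈
  ... | inj₁ x∈S | inj₁ y∈S = ∪≥-introˡ (+-closed x y x∈S y∈S)
  ... | inj₂ c≤x | _        = ∪≥-introʳ (≤-trans c≤x (m≤m+n x y))
  ... | inj₁ _   | inj₂ c≤y = ∪≥-introʳ (≤-trans c≤y (m≤n+m y x))
  Δ-sg : IsNumericalSemigroup (S ∪≥ c)
  Δ-sg = record
    { zero∈    = ∪≥-introˡ zero∈
    ; +-closed = closed
    ; cofinite = proj₁ cofinite , λ x N≤x → ∪≥-introˡ (proj₂ cofinite x N≤x)
    }
  Δ<m : ∀ x → 0 < x → x < m → x ∉ (S ∪≥ c)
  Δ<m x 0<x x<m = ∪≥-∉ (S<m x 0<x x<m) (<-≤-trans x<m m≤c)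

-- HasLevel m S a: ⌊F(S)/m⌋ = a (cf. frobenius⇒level and level-frobenius-bounds).
record HasLevel (m : ℕ) (S : Subset) (a : ℕ) : Set where
  field
    ⊇≥suc : S ⊇≥ suc a * m
    gap   : ℕ
    gap≥  : a * m ≤ gap
    gap∉  : gap ∉ S

open HasLevel

HasLevel-resp-≐ : S ≐ T → HasLevel m S a → HasLevel m T a
HasLevel-resp-≐ S≐T ℓ = record
  { ⊇≥suc = λ x le → ∈-resp-≐ S≐T (⊇≥suc ℓ x le)
  ; gap   = gap ℓ
  ; gap≥  = gap≥ ℓ
  ; gap∉  = ∉-resp-≐ S≐T (gap∉ ℓ)
  }

level-≮ : HasLevel m S a → HasLevel m S b → ¬ a < b
level-≮ {m} ℓ ℓ′ a<b =
  ∉⇒¬∈ (gap∉ ℓ′) (⊇≥suc ℓ (gap ℓ′) (≤-trans (*-monoˡ-≤ m a<b) (gap≥ ℓ′)))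

level-unique : HasLevel m S a → HasLevel m S b → a ≡ b
level-unique ℓ ℓ′ = ≤-antisym (≮⇒≥ (level-≮ ℓ′ ℓ)) (≮⇒≥ (level-≮ ℓ ℓ′))

level-frobenius-bounds : HasLevel m S a → IsFrobenius S f → a * m ≤ f × f < suc a * m
level-frobenius-bounds ℓ F@(f∉S , _) =
  ≤-trans (gap≥ ℓ) (∉⇒≤frobenius F (gap∉ ℓ)) , ⊇≥∧∉⇒< (⊇≥suc ℓ) f∉S

frobenius⇒level : .{{_ : NonZero m}} → IsFrobenius S f → HasLevel m S (f / m)
frobenius⇒level {m} {f = f} (f∉S , S>f) = record
  { ⊇≥suc = λ x le → S>f x (<-≤-trans f<[1+f/m]m le)
  ; gap   = f
  ; gap≥  = m/n*n≤m f m
  ; gap∉  = f∉S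
  }
  where
  f<[1+f/m]m : f < suc (f / m) * m
  f<[1+f/m]m = begin-strict
    f                 ≡⟨ m≡m%n+[m/n]*n f m ⟩
    f % m + f / m * m <⟨ +-monoˡ-< (f / m * m) (m%n<n f m) ⟩
    m + f / m * m     ∎
    where open ≤-Reasoning

level-exists : 1 < m → InL m S → ∃ (HasLevel m S)
level-exists 1<m (S-sg , S-mult) =
  _ , frobenius⇒level {{>-nonZero (<⇒≤ 1<m)}}
        (proj₂ (frobenius-exists (proj₂ (IsNumericalSemigroup.cofinite S-sg)) (one∉ S-mult 1<m)))

S∪γ⇒∪≥ : IsMultiplicity S m → HasLevel m S a → x ∈ S ⊎ InGamma S x → x ∈ (S ∪≥ a * m)
S∪γ⇒∪≥ _ _ (inj₁ x∈S) = ∪≥-introˡ x∈S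
S∪γ⇒∪≥ {m = m} {a = a} mult ℓ (inj₂ (f , μ , q , F , μ-mult , _ , f<[1+q]μ , _ , qμ≤x , _))
  with refl ← multiplicity-unique μ-mult mult =
  ∪≥-introʳ (≤-trans (*-monoˡ-≤ m a≤q) qμ≤x)
  where
  a≤q : a ≤ q
  a≤q = ≤-pred (*-cancelʳ-< m a (suc q) (≤-<-trans (proj₁ (level-frobenius-bounds ℓ F)) f<[1+q]μ))

∪≥⇒S∪γ : IsMultiplicity S m → HasLevel m S a → x ∈ (S ∪≥ a * m) → x ∈ S ⊎ InGamma S x
∪≥⇒S∪γ {S} {m} {a} {x} mult ℓ x∈
  with ∪≥-elim {S = S} x∈ | ∈-or-∉ S x | frobenius-exists (⊇≥suc ℓ) (gap∉ ℓ)
... | inj₁ x∈S | _        | _      = inj₁ x∈S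
... | inj₂ _   | inj₁ x∈S | _      = inj₁ x∈S
... | inj₂ am≤x | inj₂ x∉S | f , F = inj₂
  (f , m , a , F , mult , proj₁ bounds , proj₂ bounds , x∉S , am≤x , ∉⇒≤frobenius F x∉S)
  where
  bounds : a * m ≤ f × f < suc a * m
  bounds = level-frobenius-bounds ℓ F

edge-target : Edge m S T → HasLevel m S a → T ≐ (S ∪≥ a * m)
edge-target ((_ , mult) , _ , _ , T⊆S∪γ , S∪γ⊆T) ℓ = ≐-intro
  (λ x x∈T → S∪γ⇒∪≥ mult ℓ (T⊆S∪γ x x∈T))
  (λ x x∈ → S∪γ⊆T x (∪≥⇒S∪γ mult ℓ x∈))

∪≥-edge : InL m S → HasLevel m S (suc n) → Edge m S (S ∪≥ suc n * m)
∪≥-edge {m} {S} {n} S∈L@(_ , mult) ℓ =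
  S∈L , ∪≥-InL S∈L (m≤m+n m (n * m)) , S≢ , (λ _ → ∪≥⇒S∪γ mult ℓ) , (λ _ → S∪γ⇒∪≥ mult ℓ)
  where
  S≢ : ¬ (S ≐ (S ∪≥ suc n * m))
  S≢ S≐ = ∉⇒¬∈ (gap∉ ℓ) (∈-resp-≐ (≐-sym S≐) (∪≥-introʳ (gap≥ ℓ)))

∪≥-level : InL m S → HasLevel m S (suc n) → HasLevel m (S ∪≥ suc n * m) n
∪≥-level {m} {n = n} (S-sg , _ , m∈S , _) ℓ = record
  { ⊇≥suc = λ _ → ∪≥-introʳ
  ; gap   = gap ℓ ∸ m
  ; gap≥  = subst (_≤ gap ℓ ∸ m) (m+n∸m≡n m (n * m)) (∸-monoˡ-≤ m (gap≥ ℓ))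
  ; gap∉  = ∪≥-∉ (∸-∉ S-sg m∈S (gap∉ ℓ) m≤gap) gap∸m<
  }
  where
  m≤gap : m ≤ gap ℓ
  m≤gap = ≤-trans (m≤m+n m (n * m)) (gap≥ ℓ)
  gap∸m< : gap ℓ ∸ m < suc n * m
  gap∸m< = subst (gap ℓ ∸ m <_) (m+n∸m≡n m (suc n * m))
    (∸-monoˡ-< (⊇≥∧∉⇒< (⊇≥suc ℓ) (gap∉ ℓ)) m≤gap)

-- A level-0 source would give S ∪ γ(S) = S ∪≥ 0 = ℕ, which has multiplicity 1.
edge-level : 1 < m → Edge m S T → HasLevel m T b → HasLevel m S (suc b)
edge-level {m} {S} {T} {b} 1<m e@(S∈L , (_ , T-mult) , _) T-level with level-exists 1<m S∈L
... | zero , ℓ =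
  contradiction (∈-resp-≐ (≐-sym (edge-target e ℓ)) (∪≥-introʳ z≤n)) (∉⇒¬∈ (one∉ T-mult 1<m))
... | suc a , ℓ = subst (λ a → HasLevel m S (suc a)) a≡b ℓ
  where
  a≡b : a ≡ b
  a≡b = level-unique (HasLevel-resp-≐ (≐-sym (edge-target e ℓ)) (∪≥-level S∈L ℓ)) T-level

edge-functional : 1 < m → Edge m S T → Edge m U V → S ≐ U → T ≐ V
edge-functional 1<m e e′ S≐U with level-exists 1<m (proj₁ e)
... | a , ℓ = ≐-trans (edge-target e ℓ)
  (≐-trans (∪≥-resp-≐ S≐U) (≐-sym (edge-target e′ (HasLevel-resp-≐ S≐U ℓ))))

rootSG-intro : x ≡ 0 ⊎ m ≤ x → x ∈ rootSG m
rootSG-intro {x = zero}  _           = refl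
rootSG-intro {x = suc x} (inj₁ ())
rootSG-intro {x = suc x} (inj₂ m≤x) = ≤ᵇ-true m≤x

rootSG-elim : x ∈ rootSG m → x ≡ 0 ⊎ m ≤ x
rootSG-elim {x = zero}          _ = inj₁ refl
rootSG-elim {x = suc x} {m = m} x∈ = inj₂ (≤ᵇ⇒≤ m (suc x) (Equivalence.from T-≡ x∈))

rootSG-∉ : 0 < x → x < m → x ∉ rootSG m
rootSG-∉ {x = suc x} _ x<m = ≤ᵇ-false (<⇒≱ x<m)

rootSG-InL : 0 < m → InL m (rootSG m)
rootSG-InL {m} 0<m = root-sg , 0<m , rootSG-intro {x = m} (inj₂ ≤-refl) , λ _ → rootSG-∉
  where
  closed : ∀ x y → x ∈ rootSG m → y ∈ rootSG m → (x + y) ∈ rootSG m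
  closed x y x∈ y∈ with rootSG-elim {x = x} x∈
  ... | inj₁ refl = y∈
  ... | inj₂ m≤x  = rootSG-intro (inj₂ (≤-trans m≤x (m≤m+n x y)))
  root-sg : IsNumericalSemigroup (rootSG m)
  root-sg = record
    { zero∈ = refl ; +-closed = closed ; cofinite = m , λ _ m≤x → rootSG-intro (inj₂ m≤x) }

rootSG-level : 1 < m → HasLevel m (rootSG m) 0
rootSG-level {m} 1<m = record
  { ⊇≥suc = λ x le → rootSG-intro (inj₂ (subst (_≤ x) (*-identityˡ m) le))
  ; gap   = 1
  ; gap≥  = z≤n
  ; gap∉  = rootSG-∉ z<s 1<m
  }

level-zero⇒rootSG : InL m S → HasLevel m S 0 → S ≐ rootSG m
level-zero⇒rootSG {m} {S} (S-sg , mult) ℓ = ≐-intro S⊆root root⊆S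
  where
  S⊆root : ∀ x → x ∈ S → x ∈ rootSG m
  S⊆root x x∈S with x ≟ 0
  ... | yes x≡0 = rootSG-intro (inj₁ x≡0)
  ... | no  x≢0 = rootSG-intro (inj₂ (multiplicity-≤ mult x∈S x≢0))
  root⊆S : ∀ x → x ∈ rootSG m → x ∈ S
  root⊆S x x∈ with rootSG-elim {x = x} x∈
  ... | inj₁ refl = IsNumericalSemigroup.zero∈ S-sg
  ... | inj₂ m≤x  = ⊇≥suc ℓ x (subst (_≤ x) (sym (*-identityˡ m)) m≤x)

-- (U ∖ {0}) + Δ ⊆ U and U ∖ {0} ⊆ Δ, so each layer of the tower lets a be added once more.
J^⇒⊇≥ : ∀ j → J^ j S → a ≢ 0 → a ∈ S → S ⊇≥ j * a
J^⇒⊇≥ zero S≐ℕ _ _ y _ = S≐ℕ y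
J^⇒⊇≥ {S} {a} (suc j) (Δ , Δ∈J^ , _ , _ , S⊆Δ , S+Δ⊆S) a≢0 a∈S y ja+a≤y =
  subst (_∈ S) (m+[n∸m]≡n a≤y)
    (S+Δ⊆S a (y ∸ a) a≢0 a∈S (J^⇒⊇≥ j Δ∈J^ a≢0 (S⊆Δ a a≢0 a∈S) (y ∸ a) ja≤y∸a))
  where
  a≤y : a ≤ y
  a≤y = ≤-trans (m≤m+n a (j * a)) ja+a≤y
  ja≤y∸a : j * a ≤ y ∸ a
  ja≤y∸a = subst (_≤ y ∸ a) (m+n∸m≡n a (j * a)) (∸-monoˡ-≤ a ja+a≤y)

⊇≥⇒J^ : ∀ j → InL m S → S ⊇≥ j * m → J^ j S
∪≥-J^ : ∀ j → InL m S → J^ j (S ∪≥ j * m)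

⊇≥⇒J^ zero _ S⊇ x = S⊇ x z≤n
⊇≥⇒J^ {m} {S} (suc j) S∈L@(S-sg , mult@(0<m , m∈S , _)) S⊇ =
  S ∪≥ j * m , ∪≥-J^ j S∈L , S-sg , (m , >⇒≢ 0<m , m∈S) , (λ _ _ → ∪≥-introˡ) , ideal
  where
  ideal : ∀ x y → x ≢ 0 → x ∈ S → y ∈ (S ∪≥ j * m) → (x + y) ∈ S
  ideal x y x≢0 x∈S y∈ with ∪≥-elim {S = S} y∈
  ... | inj₁ y∈S  = IsNumericalSemigroup.+-closed S-sg x y x∈S y∈S
  ... | inj₂ jm≤y = S⊇ (x + y) (+-mono-≤ (multiplicity-≤ mult x∈S x≢0) jm≤y)

∪≥-J^ zero    _   x = ∪≥-introʳ z≤n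
∪≥-J^ {m} (suc j) S∈L = ⊇≥⇒J^ (suc j) (∪≥-InL S∈L (m≤m+n m (j * m))) (λ _ → ∪≥-introʳ)

complexity-unique : HasComplexity S j → HasComplexity S k → j ≡ k
complexity-unique {j = j} {k = k} (S∈J^j , j-min) (S∈J^k , k-min) with <-cmp j k
... | tri< j<k _ _ = contradiction S∈J^j (k-min j j<k)
... | tri≈ _ j≡k _ = j≡k
... | tri> _ _ k<j = contradiction S∈J^k (j-min k k<j)

level⇒complexity : InL m S → HasLevel m S a → HasComplexity S (suc a)
level⇒complexity {m} {S} {a} S∈L@(_ , 0<m , m∈S , _) ℓ = ⊇≥⇒J^ (suc a) S∈L (⊇≥suc ℓ) , not-lower
  where
  not-lower : ∀ j → j < suc a → ¬ J^ j S
  not-lower j j≤a S∈J^j = ∉⇒¬∈ (gap∉ ℓ)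
    (J^⇒⊇≥ j S∈J^j (>⇒≢ 0<m) m∈S (gap ℓ) (≤-trans (*-monoˡ-≤ m (≤-pred j≤a)) (gap≥ ℓ)))

complexity⇒level : 1 < m → InL m S → HasComplexity S (suc n) → HasLevel m S n
complexity⇒level {m} {S} 1<m S∈L C with level-exists 1<m S∈L
... | a , ℓ = subst (HasLevel m S) (suc-injective (complexity-unique (level⇒complexity S∈L ℓ) C)) ℓ

IsWalk : ℕ → (ℕ → Subset) → ℕ → Set
IsWalk m vs n = ∀ i → i < n → Edge m (vs i) (vs (suc i))

walk-level : 1 < m → IsWalk m vs n → HasLevel m (vs n) a →
             ∀ d i → d + i ≡ n → HasLevel m (vs i) (d + a)
walk-level _   _    ℓ zero    _ refl = ℓ
walk-level 1<m walk ℓ (suc d) i refl =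
  edge-level 1<m (walk i (s≤s (m≤n+m i d))) (walk-level 1<m walk ℓ d (suc i) (+-suc d i))

walk-vertices-distinct : 1 < m → IsWalk m vs n → HasLevel m (vs n) a →
                         i ≤ n → j ≤ n → i ≢ j → ¬ (vs i ≐ vs j)
walk-vertices-distinct {m} {vs} {n} {a} {i} {j} 1<m walk ℓ i≤n j≤n i≢j vi≐vj =
  i≢j (∸-cancelˡ-≡ i≤n j≤n (+-cancelʳ-≡ a (n ∸ i) (n ∸ j) same-level))
  where
  level-at : ∀ {i} → i ≤ n → HasLevel m (vs i) (n ∸ i + a)
  level-at {i} i≤n = walk-level 1<m walk ℓ (n ∸ i) i (m∸n+n≡m i≤n)
  same-level : n ∸ i + a ≡ n ∸ j + a
  same-level = level-unique (HasLevel-resp-≐ vi≐vj (level-at i≤n)) (level-at j≤n)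

-- The canonical path from a vertex of level n: S, S ∪≥ nm, S ∪≥ (n−1)m, …, S ∪≥ m.
descent : (m n : ℕ) → Subset → ℕ → Subset
descent m n       S zero    = S
descent m zero    S (suc i) = S
descent m (suc n) S (suc i) = descent m n (S ∪≥ suc n * m) i

descent-walk : InL m S → HasLevel m S n → IsWalk m (descent m n S) n
descent-walk {n = suc n} S∈L ℓ zero    _         = ∪≥-edge S∈L ℓ
descent-walk {m} {n = suc n} S∈L ℓ (suc i) (s≤s i<n) =
  descent-walk (∪≥-InL S∈L (m≤m+n m (n * m))) (∪≥-level S∈L ℓ) i i<n

descent-end : InL m S → HasLevel m S n → descent m n S n ≐ rootSG m
descent-end {n = zero}      S∈L ℓ = level-zero⇒rootSG S∈L ℓ
descent-end {m} {n = suc n} S∈L ℓ =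
  descent-end (∪≥-InL S∈L (m≤m+n m (n * m))) (∪≥-level S∈L ℓ)

level⇒path : 1 < m → InL m S → HasLevel m S n → Path m S (rootSG m) n
level⇒path {m} {S} {n} 1<m S∈L ℓ =
  descent m n S , (λ _ → refl) , descent-end S∈L ℓ , walk , distinct-edges
  where
  walk : IsWalk m (descent m n S) n
  walk = descent-walk S∈L ℓ
  end-level : HasLevel m (descent m n S n) 0
  end-level = HasLevel-resp-≐ (≐-sym (descent-end S∈L ℓ)) (rootSG-level 1<m)
  distinct-edges : ∀ i j → i < n → j < n → i ≢ j →
                   ¬ ((descent m n S i ≐ descent m n S j) ×
                      (descent m n S (suc i) ≐ descent m n S (suc j)))
  distinct-edges i j i<n j<n i≢j (vi≐vj , _) =
    walk-vertices-distinct 1<m walk end-level (<⇒≤ i<n) (<⇒≤ j<n) i≢j vi≐vj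

path⇒level : 1 < m → Path m S (rootSG m) n → HasLevel m S n
path⇒level {m} {S} {n} 1<m (vs , v₀≐S , vₙ≐root , walk , _) =
  HasLevel-resp-≐ v₀≐S (subst (HasLevel m (vs 0)) (+-identityʳ n)
    (walk-level 1<m walk (HasLevel-resp-≐ (≐-sym vₙ≐root) (rootSG-level 1<m)) n 0 (+-identityʳ n)))

path-unique : 1 < m → (p : Path m S (rootSG m) n) (q : Path m S (rootSG m) k) → SamePath p q
path-unique {m} {S} {n} {k} 1<m p@(vs , v₀≐S , _ , walk , _) q@(ws , w₀≐S , _ , walk′ , _) =
  n≡k , agree
  where
  n≡k : n ≡ k
  n≡k = level-unique (path⇒level 1<m p) (path⇒level 1<m q)
  agree : ∀ i → i ≤ n → vs i ≐ ws i
  agree zero    _   = ≐-trans v₀≐S (≐-sym w₀≐S)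
  agree (suc i) i<n =
    edge-functional 1<m (walk i i<n) (walk′ i (subst (i <_) n≡k i<n)) (agree i (<⇒≤ i<n))

rootSG-isTree : 1 < m → IsTreeWithRoot m (rootSG m)
rootSG-isTree 1<m = rootSG-InL (<⇒≤ 1<m) , λ S S∈L _ →
  map₂ (level⇒path 1<m S∈L) (level-exists 1<m S∈L) , λ _ _ → path-unique 1<m

complexity⇔path : 1 < m → InL m S →
                  (HasComplexity S (suc n) → Path m S (rootSG m) n) ×
                  (Path m S (rootSG m) n → HasComplexity S (suc n))
complexity⇔path 1<m S∈L =
  (λ C → level⇒path 1<m S∈L (complexity⇒level 1<m S∈L C)) ,
  (λ p → level⇒complexity S∈L (path⇒level 1<m p))

corollary28 : ∀ (m : ℕ) → 2 ≤ m →
    IsTreeWithRoot m (rootSG m) ×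
    (∀ (k : ℕ) → 1 ≤ k → ∀ (S : Subset) → InL m S →
      ((HasComplexity S k → Path m S (rootSG m) (k ∸ 1)) ×
       (Path m S (rootSG m) (k ∸ 1) → HasComplexity S k)))
corollary28 m 1<m = rootSG-isTree 1<m , λ { (suc n) _ S S∈L → complexity⇔path 1<m S∈L }
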